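{- Let $\mathbb{Z}_{(2)}=(\mathbb{Z}\setminus2\mathbb{Z})^{ -1}\mathbb{Z}\subset\mathbb{Q}$ and let $\Gamma$ be a $\mathbb{Z}_{(2)}$-lattice in a Euclidean space such that $(\gamma,\gamma)\in\mathbb{Z}_{(2)}$ for all $\gamma\in\Gamma$. Let $\Gamma^{(e)}:=\{\alpha\in\Gamma\mid(\alpha,\alpha)\in2\mathbb{Z}_{(2)}\}$. If $\Gamma^{(e)}$ is a sublattice of $\Gamma$, then $[\Gamma:\Gamma^{(e)}]\in\{1,2,4\}$.
   Context: A $\mathbb{Z}_{(2)}$-lattice is a finitely generated $\mathbb{Z}_{(2)}$-submodule of a Euclidean space spanning it (equivalently $\mathbb{Z}_{(2)}\otimes L$ for a lattice $L$). -}

module Defs where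

open import Data.Nat using (ℕ; zero; suc)
open import Data.Nat.Divisibility using (_∣_)
open import Data.Fin using (Fin; zero; suc)
open import Data.Rational using (ℚ; 0ℚ; ½; _+_; _*_; _-_; _<_)
open import Data.Product using (Σ; ∃; _×_)
open import Relation.Binary.PropositionalEquality using (_≡_; _≢_)
open import Relation.Nullary using (¬_)

InZ2 : ℚ → Set
InZ2 q = ¬ (2 ∣ ℚ.denominatorℕ q)

In2Z2 : ℚ → Set
In2Z2 q = InZ2 (½ * q)

Vecℚ : ℕ → Set
Vecℚ n = Fin n → ℚ

sumℚ : ∀ {n} → (Fin n → ℚ) → ℚ
sumℚ {zero} f = 0ℚ
sumℚ {suc n} f = f zero + sumℚ (λ i → f (suc i))

Gram : ℕ → Set
Gram n = Fin n → Fin n → ℚ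

form : ∀ {n} → Gram n → Vecℚ n → Vecℚ n → ℚ
form G u v = sumℚ (λ i → sumℚ (λ j → u i * G i j * v j))

Symmetric : ∀ {n} → Gram n → Set
Symmetric {n} G = ∀ (i j : Fin n) → G i j ≡ G j i

PositiveDefinite : ∀ {n} → Gram n → Set
PositiveDefinite {n} G = ∀ (v : Vecℚ n) → (∃ λ i → v i ≢ 0ℚ) → 0ℚ < form G v v

-- The Z_(2)-lattice Γ = Z_(2)^n (coordinates w.r.t. a Z_(2)-basis).
InΓ : ∀ {n} → Vecℚ n → Set
InΓ {n} v = ∀ (i : Fin n) → InZ2 (v i)

InΓe : ∀ {n} → Gram n → Vecℚ n → Set
InΓe G v = InΓ v × In2Z2 (form G v v)

_+ᵥ_ : ∀ {n} → Vecℚ n → Vecℚ n → Vecℚ n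
(u +ᵥ v) i = u i + v i

_-ᵥ_ : ∀ {n} → Vecℚ n → Vecℚ n → Vecℚ n
(u -ᵥ v) i = u i - v i

_·ᵥ_ : ∀ {n} → ℚ → Vecℚ n → Vecℚ n
(c ·ᵥ v) i = c * v i

IsSubmodule : ∀ {n} → (Vecℚ n → Set) → Set
IsSubmodule {n} H =
  (∀ v → H v → InΓ v)
  × H (λ _ → 0ℚ)
  × (∀ u v → H u → H v → H (u +ᵥ v))
  × (∀ c v → InZ2 c → H v → H (c ·ᵥ v))

HasIndex : ∀ {n} → (Vecℚ n → Set) → ℕ → Set
HasIndex {n} H m =
  Σ (Fin m → Vecℚ n) λ r →
    (∀ i → InΓ (r i))
    × (∀ i j → H (r i -ᵥ r j) → i ≡ j)
    × (∀ γ → InΓ γ → ∃ λ i → H (γ -ᵥ r i))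

{-# OPTIONS --safe #-}
-- Since 2Γ ⊆ Γᵉ, the quotient Γ/Γᵉ is an F₂-vector space whose nonzero classes are the
-- classes of odd norm. Reducing the polarization identity
--   (a+b+c,a+b+c) + (a,a) + (b,b) + (c,c) = (a+b,a+b) + (a+c,a+c) + (b+c,b+c)
-- modulo 2Z₍₂₎ shows that a, b, c, a+b, a+c, b+c, a+b+c cannot all have odd norm, so
-- dim Γ/Γᵉ ≤ 2. The standard basis decides the index: if it lies in Γᵉ the index is 1; if some
-- e_a is odd and every e_i lies in Γᵉ ∪ (e_a + Γᵉ), that union is a Z₍₂₎-submodule containing
-- the basis and the index is 2; otherwise 0, e_a, e_b, e_b − e_a lie in four distinct cosets
-- and the dimension bound leaves no room for a fifth.
-- Parities in Z₍₂₎ are read off any fraction with odd denominator, since the reduced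
-- denominator divides it.

module Submission where

open import Defs
open import Algebra.Properties.CommutativeMonoid.Sum as ∑ using ()
open import Data.Empty using (⊥; ⊥-elim)
open import Data.Fin using (Fin; zero; suc)
open import Data.Fin.Patterns using (0F; 1F; 2F; 3F)
open import Data.Fin.Properties using (all?; any?; ¬∀⟶∃¬)
open import Data.Integer as ℤ using (+_; -[1+_]; ∣_∣)
import Data.Integer.Properties as ℤP
open import Data.Integer.DivMod using (_%ℕ_; _/ℕ_; n%ℕd<d; a≡a%ℕn+[a/ℕn]*n)
open import Data.Integer.GCD using (gcd)
open import Data.Integer.Tactic.RingSolver using () renaming (solve-∀ to ℤ-solve-∀)
open import Data.Nat as ℕ using (ℕ; zero; suc; s≤s)
open import Data.Nat.Divisibility using (_∣_; _∣?_; divides; ∣-trans; ∣1⇒≡1; m∣m*n)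
open import Data.Nat.Primality using (euclidsLemma; prime[2])
open import Data.Product using (∃; _×_; _,_; proj₁; proj₂)
open import Data.Rational using (ℚ; mkℚ; 0ℚ; 1ℚ; ½; _+_; _*_; _-_; -_; _/_; ↥_; ↧_; ↧ₙ_; toℚᵘ)
open import Data.Rational.Properties
  using (_≟_; +-*-commutativeRing; +-0-commutativeMonoid; *-distribˡ-+; *-zeroʳ; *-identityʳ;
         +-identityˡ; +-identityʳ; ↧-/; ↧-neg; fromℚᵘ-cong; fromℚᵘ-toℚᵘ; toℚᵘ-homo-*; toℚᵘ-homo-+)
open import Data.Rational.Unnormalised using (mkℚᵘ; *≡*)
  renaming (_≃_ to _≃ᵘ_; _+_ to _+ᵘ_; _*_ to _*ᵘ_)
import Data.Rational.Unnormalised.Properties as ℚᵘP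
open import Data.Sum using (_⊎_; inj₁; inj₂)
open import Function using (_∘_; case_of_)
open import Level using (0ℓ)
open import Relation.Binary.PropositionalEquality
  using (_≡_; _≗_; refl; sym; trans; cong; cong₂; subst; module ≡-Reasoning)
open import Relation.Nullary using (¬_; Dec; yes; no; ¬?; contradiction)
open import Relation.Nullary.Decidable using (_×-dec_; _⊎-dec_; dec⇒maybe)
open import Tactic.RingSolver using (solve-∀)
import Tactic.RingSolver.Core.AlmostCommutativeRing as ACR

ℚ-ring : ACR.AlmostCommutativeRing 0ℓ 0ℓ
ℚ-ring = ACR.fromCommutativeRing +-*-commutativeRing (λ q → dec⇒maybe (0ℚ ≟ q))

¬2∣1 : ¬ 2 ∣ 1
¬2∣1 2∣1 = contradiction (∣1⇒≡1 2∣1) λ ()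

odd*odd : ∀ {m n} → ¬ 2 ∣ m → ¬ 2 ∣ n → ¬ 2 ∣ m ℕ.* n
odd*odd {m} {n} ¬2∣m ¬2∣n 2∣mn with euclidsLemma m n prime[2] 2∣mn
... | inj₁ 2∣m = ¬2∣m 2∣m
... | inj₂ 2∣n = ¬2∣n 2∣n

ℤ-parity : ∀ a → (∃ λ k → a ≡ k ℤ.* + 2) ⊎ (∃ λ k → a ≡ + 1 ℤ.+ k ℤ.* + 2)
ℤ-parity a with a %ℕ 2 | n%ℕd<d a 2 | a≡a%ℕn+[a/ℕn]*n a 2
... | 0           | _            | a≡ = inj₁ (a /ℕ 2 , trans a≡ (ℤP.+-identityˡ _))
... | 1           | _            | a≡ = inj₂ (a /ℕ 2 , a≡)
... | suc (suc _) | s≤s (s≤s ()) | _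

InZ2-/ : ∀ i n .{{_ : ℕ.NonZero n}} → ¬ 2 ∣ n → InZ2 (i / n)
InZ2-/ i n ¬2∣n 2∣den = ¬2∣n (subst (2 ∣_) den*g≡n (∣-trans 2∣den (m∣m*n _)))
  where
  den*g≡n : ↧ₙ (i / n) ℕ.* ∣ gcd i (+ n) ∣ ≡ n
  den*g≡n = trans (sym (ℤP.abs-* (↧ (i / n)) (gcd i (+ n)))) (cong ∣_∣ (↧-/ i n))

InZ2-+ : ∀ p q → InZ2 p → InZ2 q → InZ2 (p + q)
InZ2-+ p@(mkℚ _ _ _) q@(mkℚ _ _ _) p∈ q∈ =
  InZ2-/ (↥ p ℤ.* ↧ q ℤ.+ ↥ q ℤ.* ↧ p) (↧ₙ p ℕ.* ↧ₙ q) (odd*odd p∈ q∈)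

InZ2-neg : ∀ q → InZ2 q → InZ2 (- q)
InZ2-neg q = subst (λ d → ¬ 2 ∣ d) (sym (cong ∣_∣ (↧-neg q)))

InZ2-- : ∀ p q → InZ2 p → InZ2 q → InZ2 (p - q)
InZ2-- p q p∈ q∈ = InZ2-+ p (- q) p∈ (InZ2-neg q q∈)

InZ2-0 : InZ2 0ℚ
InZ2-0 = ¬2∣1

InZ2-1 : InZ2 1ℚ
InZ2-1 = ¬2∣1

InZ2? : ∀ q → Dec (InZ2 q)
InZ2? q = ¬? (2 ∣? ↧ₙ q)

InZ2-fraction : ∀ q i d-1 → toℚᵘ q ≃ᵘ mkℚᵘ i d-1 → ¬ 2 ∣ suc d-1 → InZ2 q
InZ2-fraction q i d-1 q≃ ¬2∣d =
  subst InZ2 (trans (sym (fromℚᵘ-cong q≃)) (fromℚᵘ-toℚᵘ q)) (InZ2-/ i (suc d-1) ¬2∣d)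

In2Z2-fraction : ∀ q k d-1 → toℚᵘ q ≃ᵘ mkℚᵘ (k ℤ.* + 2) d-1 → ¬ 2 ∣ suc d-1 → In2Z2 q
In2Z2-fraction q k d-1 q≃ = InZ2-fraction (½ * q) k d-1 (begin
  toℚᵘ (½ * q)                    ≈⟨ toℚᵘ-homo-* ½ q ⟩
  toℚᵘ ½ *ᵘ toℚᵘ q                ≈⟨ ℚᵘP.*-congˡ {toℚᵘ ½} q≃ ⟩
  toℚᵘ ½ *ᵘ mkℚᵘ (k ℤ.* + 2) d-1  ≈⟨ *≡* cross ⟩
  mkℚᵘ k d-1                      ∎)
  where
  open ℚᵘP.≃-Reasoning
  cross : (+ 1 ℤ.* (k ℤ.* + 2)) ℤ.* + suc d-1 ≡ k ℤ.* + (2 ℕ.* suc d-1)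
  cross = trans (halve k (+ suc d-1)) (cong (k ℤ.*_) (sym (ℤP.pos-* 2 (suc d-1))))
    where
    halve : ∀ k d → (+ 1 ℤ.* (k ℤ.* + 2)) ℤ.* d ≡ k ℤ.* (+ 2 ℤ.* d)
    halve = ℤ-solve-∀

In2Z2-parity : ∀ q → InZ2 q → In2Z2 q ⊎ In2Z2 (q - 1ℚ)
In2Z2-parity q@(mkℚ a d-1 _) ¬2∣d with ℤ-parity a | ℤ-parity (+ suc d-1)
... | inj₁ (k , a≡) | _ =
  inj₁ (In2Z2-fraction q k d-1 (*≡* (cong (ℤ._* + suc d-1) a≡)) ¬2∣d)
... | inj₂ _ | inj₁ (e , d≡) =
  ⊥-elim (¬2∣d (divides ∣ e ∣ (trans (cong ∣_∣ d≡) (ℤP.abs-* e (+ 2)))))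
... | inj₂ (k , a≡) | inj₂ (e , d≡) = inj₂ (In2Z2-fraction (q - 1ℚ) (k ℤ.- e) d-1 (begin
  toℚᵘ (q - 1ℚ)                   ≈⟨ toℚᵘ-homo-+ q (- 1ℚ) ⟩
  toℚᵘ q +ᵘ toℚᵘ (- 1ℚ)           ≈⟨ *≡* cross ⟩
  mkℚᵘ ((k ℤ.- e) ℤ.* + 2) d-1    ∎) ¬2∣d)
  where
  open ℚᵘP.≃-Reasoning
  D = + suc d-1
  -- the numerator of q − 1 over the odd denominator d of q is a − d = 2 (k − e)
  cross : (a ℤ.* + 1 ℤ.+ -[1+ 0 ] ℤ.* D) ℤ.* D ≡ ((k ℤ.- e) ℤ.* + 2) ℤ.* + (suc d-1 ℕ.* 1)
  cross = trans (cong (ℤ._* D) (cong₂ (λ a d → a ℤ.* + 1 ℤ.+ -[1+ 0 ] ℤ.* d) a≡ d≡))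
         (trans (difference k e D) (cong ((k ℤ.- e) ℤ.* + 2 ℤ.*_) (sym (ℤP.pos-* (suc d-1) 1))))
    where
    difference : ∀ k e D → ((+ 1 ℤ.+ k ℤ.* + 2) ℤ.* + 1 ℤ.+ -[1+ 0 ] ℤ.* (+ 1 ℤ.+ e ℤ.* + 2)) ℤ.* D
                        ≡ ((k ℤ.- e) ℤ.* + 2) ℤ.* (D ℤ.* + 1)
    difference = ℤ-solve-∀

Odd : ℚ → Set
Odd q = InZ2 q × ¬ In2Z2 q

In2Z2-+ : ∀ p q → In2Z2 p → In2Z2 q → In2Z2 (p + q)
In2Z2-+ p q p∈ q∈ = subst InZ2 (sym (*-distribˡ-+ ½ p q)) (InZ2-+ (½ * p) (½ * q) p∈ q∈)

In2Z2-- : ∀ p q → In2Z2 p → In2Z2 q → In2Z2 (p - q)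
In2Z2-- p q p∈ q∈ = subst InZ2 (sym (half-distrib p q)) (InZ2-- (½ * p) (½ * q) p∈ q∈)
  where
  half-distrib : ∀ p q → ½ * (p - q) ≡ ½ * p - ½ * q
  half-distrib = solve-∀ ℚ-ring

In2Z2-double : ∀ q → InZ2 q → In2Z2 (q + q)
In2Z2-double q = subst InZ2 (sym (half-double q))
  where
  half-double : ∀ q → ½ * (q + q) ≡ q
  half-double = solve-∀ ℚ-ring

odd⇒pred-even : ∀ q → Odd q → In2Z2 (q - 1ℚ)
odd⇒pred-even q (q∈ , q-odd) = case In2Z2-parity q q∈ of λ where
  (inj₁ q-even)   → contradiction q-even q-odd
  (inj₂ q-1-even) → q-1-even

odd+odd : ∀ p q → Odd p → Odd q → In2Z2 (p + q)
odd+odd p q p-odd q-odd = subst In2Z2 (sym (shift p q))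
  (In2Z2-+ ((p - 1ℚ) + (q - 1ℚ)) (1ℚ + 1ℚ)
    (In2Z2-+ (p - 1ℚ) (q - 1ℚ) (odd⇒pred-even p p-odd) (odd⇒pred-even q q-odd))
    (In2Z2-double 1ℚ InZ2-1))
  where
  shift : ∀ p q → p + q ≡ ((p - 1ℚ) + (q - 1ℚ)) + (1ℚ + 1ℚ)
  shift = solve-∀ ℚ-ring

odd+even : ∀ p q → ¬ In2Z2 p → In2Z2 q → ¬ In2Z2 (p + q)
odd+even p q p-odd q-even p+q-even =
  p-odd (subst In2Z2 (cancel p q) (In2Z2-- (p + q) q p+q-even q-even))
  where
  cancel : ∀ p q → (p + q) - q ≡ p
  cancel = solve-∀ ℚ-ring

0ᵥ : ∀ {n} → Vecℚ n
0ᵥ _ = 0ℚ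

basis : ∀ {n} → Fin n → Vecℚ n
basis zero    zero    = 1ℚ
basis zero    (suc _) = 0ℚ
basis (suc _) zero    = 0ℚ
basis (suc i) (suc j) = basis i j

-ᵥ-identityʳ : ∀ {n} (v : Vecℚ n) → v -ᵥ 0ᵥ ≗ v
-ᵥ-identityʳ v i = +-identityʳ (v i)

InΓ-0ᵥ : ∀ {n} → InΓ (0ᵥ {n})
InΓ-0ᵥ _ = InZ2-0

InΓ-basis : ∀ {n} (i : Fin n) → InΓ (basis i)
InΓ-basis zero    zero    = InZ2-1
InΓ-basis zero    (suc _) = InZ2-0
InΓ-basis (suc _) zero    = InZ2-0
InΓ-basis (suc i) (suc j) = InΓ-basis i j

InΓ-+ : ∀ {n} (u v : Vecℚ n) → InΓ u → InΓ v → InΓ (u +ᵥ v)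
InΓ-+ u v u∈ v∈ i = InZ2-+ (u i) (v i) (u∈ i) (v∈ i)

InΓ-- : ∀ {n} (u v : Vecℚ n) → InΓ u → InΓ v → InΓ (u -ᵥ v)
InΓ-- u v u∈ v∈ i = InZ2-- (u i) (v i) (u∈ i) (v∈ i)

open ∑ +-0-commutativeMonoid using (sum; ∑-distrib-+; sum-cong-≗; sum-replicate-zero)

sumℚ≡sum : ∀ {n} (f : Fin n → ℚ) → sumℚ f ≡ sum f
sumℚ≡sum {zero}  f = refl
sumℚ≡sum {suc n} f = cong (_+_ (f zero)) (sumℚ≡sum (f ∘ suc))

sumℚ-cong : ∀ {n} {f g : Fin n → ℚ} → f ≗ g → sumℚ f ≡ sumℚ g
sumℚ-cong {f = f} {g} f≗g = trans (sumℚ≡sum f) (trans (sum-cong-≗ f≗g) (sym (sumℚ≡sum g)))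

sumℚ-+ : ∀ {n} (f g : Fin n → ℚ) → sumℚ (λ i → f i + g i) ≡ sumℚ f + sumℚ g
sumℚ-+ f g = trans (sumℚ≡sum (λ i → f i + g i))
  (trans (∑-distrib-+ f g) (sym (cong₂ _+_ (sumℚ≡sum f) (sumℚ≡sum g))))

sumℚ-*-zero : ∀ {n} (f : Fin n → ℚ) → sumℚ (λ k → f k * 0ℚ) ≡ 0ℚ
sumℚ-*-zero {n} f =
  trans (sumℚ≡sum (λ k → f k * 0ℚ)) (trans (sum-cong-≗ (*-zeroʳ ∘ f)) (sum-replicate-zero n))

sumℚ-*-basis : ∀ {n} (f : Vecℚ n) j → sumℚ (λ k → f k * basis k j) ≡ f j
sumℚ-*-basis f zero = begin
  f zero * 1ℚ + sumℚ (λ k → f (suc k) * 0ℚ)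
    ≡⟨ cong₂ _+_ (*-identityʳ (f zero)) (sumℚ-*-zero (f ∘ suc)) ⟩
  f zero + 0ℚ
    ≡⟨ +-identityʳ (f zero) ⟩
  f zero ∎
  where open ≡-Reasoning
sumℚ-*-basis f (suc j) = begin
  f zero * 0ℚ + sumℚ (λ k → f (suc k) * basis k j)
    ≡⟨ cong₂ _+_ (*-zeroʳ (f zero)) (sumℚ-*-basis (f ∘ suc) j) ⟩
  0ℚ + f (suc j)
    ≡⟨ +-identityˡ (f (suc j)) ⟩
  f (suc j) ∎
  where open ≡-Reasoning

record Z2Closed {n} (H : Vecℚ n → Set) : Set where
  field
    resp-≗   : ∀ {u v} → u ≗ v → H u → H v
    0ᵥ∈      : H 0ᵥ
    +-closed : ∀ u v → H u → H v → H (u +ᵥ v)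
    ·-closed : ∀ c v → InZ2 c → H v → H (c ·ᵥ v)

basis-span : ∀ {n} {H : Vecℚ n → Set} → Z2Closed H → (∀ i → H (basis i)) → ∀ γ → InΓ γ → H γ
basis-span {n} {H} closed basis∈ γ γ∈ = resp-≗ (sumℚ-*-basis γ)
  (combination (λ k → γ k ·ᵥ basis k) (λ k → ·-closed (γ k) (basis k) (γ∈ k) (basis∈ k)))
  where
  open Z2Closed closed
  combination : ∀ {m} (t : Fin m → Vecℚ n) → (∀ k → H (t k)) → H (λ j → sumℚ (λ k → t k j))
  combination {zero}  t t∈ = 0ᵥ∈
  combination {suc m} t t∈ =
    +-closed (t zero) _ (t∈ zero) (combination (t ∘ suc) (t∈ ∘ suc))

Σ² : ∀ {n} → (Fin n → Fin n → ℚ) → ℚ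
Σ² T = sumℚ (λ i → sumℚ (T i))

Σ²-cong : ∀ {n} {T U : Fin n → Fin n → ℚ} → (∀ i j → T i j ≡ U i j) → Σ² T ≡ Σ² U
Σ²-cong T≡U = sumℚ-cong (λ i → sumℚ-cong (T≡U i))

Σ²-+ : ∀ {n} (T U : Fin n → Fin n → ℚ) → Σ² (λ i j → T i j + U i j) ≡ Σ² T + Σ² U
Σ²-+ T U =
  trans (sumℚ-cong (λ i → sumℚ-+ (T i) (U i))) (sumℚ-+ (λ i → sumℚ (T i)) (λ i → sumℚ (U i)))

norm : ∀ {n} → Gram n → Vecℚ n → ℚ
norm G v = form G v v

module _ {n} (G : Gram n) where

  private
    term : Vecℚ n → Fin n → Fin n → ℚ
    term v i j = v i * G i j * v j

  norm-cong : ∀ {u v} → u ≗ v → norm G u ≡ norm G v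
  norm-cong u≗v = Σ²-cong (λ i j → cong₂ (λ x y → x * G i j * y) (u≗v i) (u≗v j))

  norm-polarization : ∀ a b c →
    (norm G ((a +ᵥ b) +ᵥ c) + norm G a) + (norm G b + norm G c)
    ≡ norm G (a +ᵥ b) + (norm G (a +ᵥ c) + norm G (b +ᵥ c))
  norm-polarization a b c = begin
    (norm G abc + norm G a) + (norm G b + norm G c)
      ≡⟨ cong₂ _+_ (Σ²-+ (term abc) (term a)) (Σ²-+ (term b) (term c)) ⟨
    Σ² (λ i j → term abc i j + term a i j) + Σ² (λ i j → term b i j + term c i j)
      ≡⟨ Σ²-+ (λ i j → term abc i j + term a i j) (λ i j → term b i j + term c i j) ⟨
    Σ² (λ i j → (term abc i j + term a i j) + (term b i j + term c i j))
      ≡⟨ Σ²-cong (λ i j → termwise (a i) (a j) (b i) (b j) (c i) (c j) (G i j)) ⟩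
    Σ² (λ i j → term (a +ᵥ b) i j + (term (a +ᵥ c) i j + term (b +ᵥ c) i j))
      ≡⟨ Σ²-+ (term (a +ᵥ b)) (λ i j → term (a +ᵥ c) i j + term (b +ᵥ c) i j) ⟩
    norm G (a +ᵥ b) + Σ² (λ i j → term (a +ᵥ c) i j + term (b +ᵥ c) i j)
      ≡⟨ cong (_+_ (norm G (a +ᵥ b))) (Σ²-+ (term (a +ᵥ c)) (term (b +ᵥ c))) ⟩
    norm G (a +ᵥ b) + (norm G (a +ᵥ c) + norm G (b +ᵥ c)) ∎
    where
    open ≡-Reasoning
    abc = (a +ᵥ b) +ᵥ c
    termwise : ∀ aᵢ aⱼ bᵢ bⱼ cᵢ cⱼ g →
      ((aᵢ + bᵢ + cᵢ) * g * (aⱼ + bⱼ + cⱼ) + aᵢ * g * aⱼ) + (bᵢ * g * bⱼ + cᵢ * g * cⱼ)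
      ≡ (aᵢ + bᵢ) * g * (aⱼ + bⱼ) + ((aᵢ + cᵢ) * g * (aⱼ + cⱼ) + (bᵢ + cᵢ) * g * (bⱼ + cⱼ))
    termwise = solve-∀ ℚ-ring

  norm-double : ∀ v → norm G (v +ᵥ v) ≡ (norm G v + norm G v) + (norm G v + norm G v)
  norm-double v = begin
    norm G (v +ᵥ v)
      ≡⟨ Σ²-cong (λ i j → termwise (v i) (v j) (G i j)) ⟩
    Σ² (λ i j → (term v i j + term v i j) + (term v i j + term v i j))
      ≡⟨ Σ²-+ (λ i j → term v i j + term v i j) (λ i j → term v i j + term v i j) ⟩
    Σ² (λ i j → term v i j + term v i j) + Σ² (λ i j → term v i j + term v i j)
      ≡⟨ cong₂ _+_ (Σ²-+ (term v) (term v)) (Σ²-+ (term v) (term v)) ⟩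
    (norm G v + norm G v) + (norm G v + norm G v) ∎
    where
    open ≡-Reasoning
    termwise : ∀ vᵢ vⱼ g →
      (vᵢ + vᵢ) * g * (vⱼ + vⱼ) ≡ (vᵢ * g * vⱼ + vᵢ * g * vⱼ) + (vᵢ * g * vⱼ + vᵢ * g * vⱼ)
    termwise = solve-∀ ℚ-ring

all-or-counterexample : ∀ {n p} {P : Fin n → Set p} →
                        (∀ i → Dec (P i)) → (∀ i → P i) ⊎ ∃ λ i → ¬ P i
all-or-counterexample {n} {P = P} P? with all? P?
... | yes ∀P = inj₁ ∀P
... | no ¬∀P = inj₂ (¬∀⟶∃¬ n P P? ¬∀P)

module EvenSublattice {n} (G : Gram n)
  (integral : ∀ γ → InΓ γ → InZ2 (form G γ γ))
  (Γᵉ-submodule : IsSubmodule (InΓe G)) where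

  Γᵉ : Vecℚ n → Set
  Γᵉ = InΓe G

  Γᵉ? : ∀ v → Dec (Γᵉ v)
  Γᵉ? v = all? (InZ2? ∘ v) ×-dec InZ2? (½ * norm G v)

  Γᵉ-closed : Z2Closed Γᵉ
  Γᵉ-closed = record
    { resp-≗   = λ u≗v (u∈ , even) →
                   (λ i → subst InZ2 (u≗v i) (u∈ i)) , subst In2Z2 (norm-cong G u≗v) even
    ; 0ᵥ∈      = proj₁ (proj₂ Γᵉ-submodule)
    ; +-closed = proj₁ (proj₂ (proj₂ Γᵉ-submodule))
    ; ·-closed = proj₂ (proj₂ (proj₂ Γᵉ-submodule))
    }

  open Z2Closed Γᵉ-closed
    renaming (resp-≗ to Γᵉ-resp; 0ᵥ∈ to Γᵉ-0ᵥ; +-closed to Γᵉ-+; ·-closed to Γᵉ-·)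

  Γᵉ-sym : ∀ u v → Γᵉ (u -ᵥ v) → Γᵉ (v -ᵥ u)
  Γᵉ-sym u v e =
    Γᵉ-resp (λ i → negate (u i) (v i)) (Γᵉ-· (- 1ℚ) (u -ᵥ v) (InZ2-neg 1ℚ InZ2-1) e)
    where
    negate : ∀ x y → - 1ℚ * (x - y) ≡ y - x
    negate = solve-∀ ℚ-ring

  Γᵉ-double : ∀ x → InΓ x → Γᵉ (x +ᵥ x)
  Γᵉ-double x x∈ = InΓ-+ x x x∈ x∈ ,
    subst In2Z2 (sym (norm-double G x)) (In2Z2-double (s + s) (InZ2-+ s s s∈ s∈))
    where
    s = norm G x
    s∈ = integral x x∈

  drop-0ᵥ : ∀ v → Γᵉ (v -ᵥ 0ᵥ) → Γᵉ v
  drop-0ᵥ v = Γᵉ-resp (-ᵥ-identityʳ v)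

  odd-norm : ∀ v → InΓ v → ¬ Γᵉ v → Odd (norm G v)
  odd-norm v v∈ v∉ = integral v v∈ , λ even → v∉ (v∈ , even)

  no-independent-triple : ∀ a b c → InΓ a → InΓ b → InΓ c →
    ¬ Γᵉ a → ¬ Γᵉ b → ¬ Γᵉ c → ¬ Γᵉ (a +ᵥ b) → ¬ Γᵉ (a +ᵥ c) → ¬ Γᵉ (b +ᵥ c) →
    ¬ Γᵉ ((a +ᵥ b) +ᵥ c) → ⊥
  no-independent-triple a b c a∈ b∈ c∈ a∉ b∉ c∉ ab∉ ac∉ bc∉ abc∉ =
    odd+even (N ab) (N ac + N bc) (proj₂ (odd-norm ab ab∈ ab∉))
      (odd+odd (N ac) (N bc)
        (odd-norm ac (InΓ-+ a c a∈ c∈) ac∉) (odd-norm bc (InΓ-+ b c b∈ c∈) bc∉))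
      (subst In2Z2 (norm-polarization G a b c)
        (In2Z2-+ (N abc + N a) (N b + N c)
          (odd+odd (N abc) (N a)
            (odd-norm abc (InΓ-+ ab c ab∈ c∈) abc∉) (odd-norm a a∈ a∉))
          (odd+odd (N b) (N c) (odd-norm b b∈ b∉) (odd-norm c c∈ c∉))))
    where
    N = norm G
    ab = a +ᵥ b
    ac = a +ᵥ c
    bc = b +ᵥ c
    abc = ab +ᵥ c
    ab∈ = InΓ-+ a b a∈ b∈

  index-1 : (∀ i → Γᵉ (basis i)) → HasIndex Γᵉ 1
  index-1 basis∈ = (λ _ → 0ᵥ) , (λ _ → InΓ-0ᵥ) , (λ { zero zero _ → refl }) , covers
    where
    covers : ∀ γ → InΓ γ → ∃ λ (i : Fin 1) → Γᵉ (γ -ᵥ 0ᵥ)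
    covers γ γ∈ = zero , Γᵉ-resp (sym ∘ -ᵥ-identityʳ γ) (basis-span Γᵉ-closed basis∈ γ γ∈)

  TwoCosets : Vecℚ n → Vecℚ n → Set
  TwoCosets x v = Γᵉ v ⊎ Γᵉ (v -ᵥ x)

  two-cosets-closed : ∀ x → InΓ x → Z2Closed (TwoCosets x)
  two-cosets-closed x x∈ = record
    { resp-≗ = resp ; 0ᵥ∈ = inj₁ Γᵉ-0ᵥ ; +-closed = plus ; ·-closed = scale }
    where
    2x∈ : Γᵉ (x +ᵥ x)
    2x∈ = Γᵉ-double x x∈

    resp : ∀ {u v} → u ≗ v → TwoCosets x u → TwoCosets x v
    resp u≗v (inj₁ e) = inj₁ (Γᵉ-resp u≗v e)
    resp u≗v (inj₂ e) = inj₂ (Γᵉ-resp (λ i → cong (_- x i) (u≗v i)) e)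

    plus : ∀ u v → TwoCosets x u → TwoCosets x v → TwoCosets x (u +ᵥ v)
    plus u v (inj₁ eu) (inj₁ ev) = inj₁ (Γᵉ-+ u v eu ev)
    plus u v (inj₁ eu) (inj₂ ev) =
      inj₂ (Γᵉ-resp (λ i → regroup (u i) (v i) (x i)) (Γᵉ-+ u (v -ᵥ x) eu ev))
      where
      regroup : ∀ u v x → u + (v - x) ≡ (u + v) - x
      regroup = solve-∀ ℚ-ring
    plus u v (inj₂ eu) (inj₁ ev) =
      inj₂ (Γᵉ-resp (λ i → regroup (u i) (v i) (x i)) (Γᵉ-+ (u -ᵥ x) v eu ev))
      where
      regroup : ∀ u v x → (u - x) + v ≡ (u + v) - x
      regroup = solve-∀ ℚ-ring
    plus u v (inj₂ eu) (inj₂ ev) = inj₁ (Γᵉ-resp (λ i → regroup (u i) (v i) (x i))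
      (Γᵉ-+ ((u -ᵥ x) +ᵥ (v -ᵥ x)) (x +ᵥ x) (Γᵉ-+ (u -ᵥ x) (v -ᵥ x) eu ev) 2x∈))
      where
      regroup : ∀ u v x → ((u - x) + (v - x)) + (x + x) ≡ u + v
      regroup = solve-∀ ℚ-ring

    -- c ≡ 0 or 1 mod 2Z₍₂₎, and (2k)·x = k·(x + x) ∈ Γᵉ.
    scale : ∀ c v → InZ2 c → TwoCosets x v → TwoCosets x (c ·ᵥ v)
    scale c v c∈ (inj₁ e) = inj₁ (Γᵉ-· c v c∈ e)
    scale c v c∈ (inj₂ e) with In2Z2-parity c c∈
    ... | inj₁ c-even = inj₁ (Γᵉ-resp (λ i → even-scale c (v i) (x i))
      (Γᵉ-+ (c ·ᵥ (v -ᵥ x)) ((½ * c) ·ᵥ (x +ᵥ x))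
        (Γᵉ-· c (v -ᵥ x) c∈ e) (Γᵉ-· (½ * c) (x +ᵥ x) c-even 2x∈)))
      where
      even-scale : ∀ c v x → c * (v - x) + (½ * c) * (x + x) ≡ c * v
      even-scale = solve-∀ ℚ-ring
    ... | inj₂ c-1-even = inj₂ (Γᵉ-resp (λ i → odd-scale c (v i) (x i))
      (Γᵉ-+ (c ·ᵥ (v -ᵥ x)) ((½ * (c - 1ℚ)) ·ᵥ (x +ᵥ x))
        (Γᵉ-· c (v -ᵥ x) c∈ e) (Γᵉ-· (½ * (c - 1ℚ)) (x +ᵥ x) c-1-even 2x∈)))
      where
      odd-scale : ∀ c v x → c * (v - x) + (½ * (c - 1ℚ)) * (x + x) ≡ c * v - x
      odd-scale = solve-∀ ℚ-ring

  index-2 : ∀ x → InΓ x → ¬ Γᵉ x → (∀ i → TwoCosets x (basis i)) → HasIndex Γᵉ 2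
  index-2 x x∈ x∉ basis∈ = r , r∈ , distinct , covers
    where
    r : Fin 2 → Vecℚ n
    r 0F = 0ᵥ
    r 1F = x

    r∈ : ∀ i → InΓ (r i)
    r∈ 0F = InΓ-0ᵥ
    r∈ 1F = x∈

    distinct : ∀ i j → Γᵉ (r i -ᵥ r j) → i ≡ j
    distinct 0F 0F _ = refl
    distinct 0F 1F e = ⊥-elim (x∉ (drop-0ᵥ x (Γᵉ-sym 0ᵥ x e)))
    distinct 1F 0F e = ⊥-elim (x∉ (drop-0ᵥ x e))
    distinct 1F 1F _ = refl

    covers : ∀ γ → InΓ γ → ∃ λ i → Γᵉ (γ -ᵥ r i)
    covers γ γ∈ with basis-span (two-cosets-closed x x∈) basis∈ γ γ∈
    ... | inj₁ e = 0F , Γᵉ-resp (sym ∘ -ᵥ-identityʳ γ) e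
    ... | inj₂ e = 1F , e

  index-4 : ∀ x y → InΓ x → InΓ y → ¬ Γᵉ x → ¬ Γᵉ y → ¬ Γᵉ (y -ᵥ x) → HasIndex Γᵉ 4
  index-4 x y x∈ y∈ x∉ y∉ y-x∉ = r , r∈ , distinct , covers
    where
    r : Fin 4 → Vecℚ n
    r 0F = 0ᵥ
    r 1F = x
    r 2F = y
    r 3F = y -ᵥ x

    r∈ : ∀ i → InΓ (r i)
    r∈ 0F = InΓ-0ᵥ
    r∈ 1F = x∈
    r∈ 2F = y∈
    r∈ 3F = InΓ-- y x y∈ x∈

    3-1∉ : ¬ Γᵉ (r 3F -ᵥ x)
    3-1∉ e =
      y∉ (Γᵉ-resp (λ i → add-back (x i) (y i)) (Γᵉ-+ (r 3F -ᵥ x) (x +ᵥ x) e (Γᵉ-double x x∈)))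
      where
      add-back : ∀ x y → ((y - x) - x) + (x + x) ≡ y
      add-back = solve-∀ ℚ-ring

    3-2∉ : ¬ Γᵉ (r 3F -ᵥ y)
    3-2∉ e = x∉ (Γᵉ-resp (λ i → cancel (x i) (y i)) (Γᵉ-sym (r 3F) y e))
      where
      cancel : ∀ x y → y - (y - x) ≡ x
      cancel = solve-∀ ℚ-ring

    distinct : ∀ i j → Γᵉ (r i -ᵥ r j) → i ≡ j
    distinct 0F 0F _ = refl
    distinct 1F 1F _ = refl
    distinct 2F 2F _ = refl
    distinct 3F 3F _ = refl
    distinct 1F 0F e = ⊥-elim (x∉ (drop-0ᵥ x e))
    distinct 2F 0F e = ⊥-elim (y∉ (drop-0ᵥ y e))
    distinct 3F 0F e = ⊥-elim (y-x∉ (drop-0ᵥ (y -ᵥ x) e))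
    distinct 2F 1F e = ⊥-elim (y-x∉ e)
    distinct 3F 1F e = ⊥-elim (3-1∉ e)
    distinct 3F 2F e = ⊥-elim (3-2∉ e)
    distinct 0F 1F e = ⊥-elim (x∉ (drop-0ᵥ x (Γᵉ-sym (r 0F) (r 1F) e)))
    distinct 0F 2F e = ⊥-elim (y∉ (drop-0ᵥ y (Γᵉ-sym (r 0F) (r 2F) e)))
    distinct 0F 3F e = ⊥-elim (y-x∉ (drop-0ᵥ (y -ᵥ x) (Γᵉ-sym (r 0F) (r 3F) e)))
    distinct 1F 2F e = ⊥-elim (y-x∉ (Γᵉ-sym (r 1F) (r 2F) e))
    distinct 1F 3F e = ⊥-elim (3-1∉ (Γᵉ-sym (r 1F) (r 3F) e))
    distinct 2F 3F e = ⊥-elim (3-2∉ (Γᵉ-sym (r 2F) (r 3F) e))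

    covers : ∀ γ → InΓ γ → ∃ λ i → Γᵉ (γ -ᵥ r i)
    covers γ γ∈ with any? (λ i → Γᵉ? (γ -ᵥ r i))
    ... | yes found = found
    ... | no none = ⊥-elim (no-independent-triple (γ -ᵥ y) x (y -ᵥ x)
            (InΓ-- γ y γ∈ y∈) x∈ (InΓ-- y x y∈ x∈) (miss 2F) x∉ y-x∉
            (miss 3F ∘ Γᵉ-resp (λ i → ab (γ i) (x i) (y i)))
            (miss 1F ∘ Γᵉ-resp (λ i → ac (γ i) (x i) (y i)))
            (y∉ ∘ Γᵉ-resp (λ i → bc (x i) (y i)))
            (miss 0F ∘ Γᵉ-resp (λ i → abc (γ i) (x i) (y i))))
      where
      miss : ∀ i → ¬ Γᵉ (γ -ᵥ r i)
      miss i e = none (i , e)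
      ab : ∀ g x y → (g - y) + x ≡ g - (y - x)
      ab = solve-∀ ℚ-ring
      ac : ∀ g x y → (g - y) + (y - x) ≡ g - x
      ac = solve-∀ ℚ-ring
      bc : ∀ x y → x + (y - x) ≡ y
      bc = solve-∀ ℚ-ring
      abc : ∀ g x y → ((g - y) + x) + (y - x) ≡ g - 0ℚ
      abc = solve-∀ ℚ-ring

lemma2p8 : (n : ℕ) (G : Gram n) → Symmetric G → PositiveDefinite G
    → (∀ γ → InΓ γ → InZ2 (form G γ γ))
    → IsSubmodule (InΓe G)
    → ∃ λ m → (m ≡ 1 ⊎ m ≡ 2 ⊎ m ≡ 4) × HasIndex (InΓe G) m
lemma2p8 n G _ _ integral Γᵉ-submodule =
  case all-or-counterexample (Γᵉ? ∘ basis) of λ where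
    (inj₁ basis-even) → 1 , inj₁ refl , index-1 basis-even
    (inj₂ (a , a-odd)) →
      case all-or-counterexample (λ i → Γᵉ? (basis i) ⊎-dec Γᵉ? (basis i -ᵥ basis a)) of λ where
        (inj₁ two-cosets) → 2 , inj₂ (inj₁ refl) ,
          index-2 (basis a) (InΓ-basis a) a-odd two-cosets
        (inj₂ (b , b-new)) → 4 , inj₂ (inj₂ refl) ,
          index-4 (basis a) (basis b) (InΓ-basis a) (InΓ-basis b)
            a-odd (b-new ∘ inj₁) (b-new ∘ inj₂)
  where open EvenSublattice G integral Γᵉ-submodule
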